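{- Let $p$ be an odd prime and $m,k$ positive integers. Then $Z_{p^{2^m}}(p^{2^m k})$ is a base-$p^{2^m}$ repdigit (with $k$ digits).
   Context: $Z_b(N)$ is the number of trailing zeroes in the base-$b$ expansion of $N!$, i.e. the largest $e\ge0$ with $b^e\mid N!$. A base-$b$ repdigit with $k$ digits is a number of the form $\alpha\frac{b^k-1}{b-1}$ with $1\le\alpha\le b-1$. -}

module Defs where

open import Data.Nat using (ℕ; suc; _+_; _*_; _∸_; _^_; _≤_)
open import Data.Nat.Divisibility using (_∣_)
open import Data.Nat.Combinatorics using ()
open import Data.Nat.Base using (_!)
open import Data.Product using (Σ; _×_)

-- IsZ b N e : e is the number of trailing zeroes of N! in base b,
-- i.e. the largest e ≥ 0 with b ^ e ∣ N !.
IsZ : ℕ → ℕ → ℕ → Set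
IsZ b N e = (b ^ e ∣ N !) × (∀ e′ → b ^ e′ ∣ N ! → e′ ≤ e)

-- n is a base-b repdigit with k digits: n = α (b^k - 1)/(b - 1), 1 ≤ α ≤ b - 1.
-- Stated division-free: n * (b - 1) = α * (b^k - 1)  (b ≥ 2 in all uses).
Repdigit : ℕ → ℕ → ℕ → Set
Repdigit b k n = Σ ℕ λ α → (1 ≤ α) × (α ≤ b ∸ 1) × (n * (b ∸ 1) ≡ α * (b ^ k ∸ 1))
  where open import Relation.Binary.PropositionalEquality using (_≡_)

module Submission where

-- Let p be an odd prime, q = 2^m and B = p^q.  The proof rests on the repunit
-- R_b(n) = 1 + b + ... + b^(n-1) and three facts about it.
--   * Legendre's formula for a prime power: (p^n)! = p^(R_p(n)) * c with p ∤ c.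
--   * Repunits are multiplicative in the sense R_p(q k) = R_p(q) * R_B(k), and
--     R_B(k) * (B - 1) = B^k - 1, so R_B(k) is the k-digit base-B repunit.
--   * For odd p, 2^m divides R_p(2^m), because R_p(2n) = R_p(n) * (1 + p^n)
--     and 1 + p^n is even.
-- Writing R_p(q) = α q, Legendre's formula gives (p^(qk))! = B^(α R_B(k)) * c
-- with p ∤ c, so Z_B(p^(qk)) = α R_B(k), a repdigit with digit α; the bound
-- α ≤ B - 1 follows from α q (p - 1) = B - 1.  The file develops repunits,
-- then the p-adic factorisation of factorials, then the general statement
-- for any q dividing R_p(q); proposition4 is its instance q = 2^m.

open import Defs
open import Data.Nat using (ℕ; suc; _*_; _^_; _≤_; _%_)
open import Data.Nat.Primality using (Prime)
open import Data.Product using (Σ; _×_)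
open import Relation.Binary.PropositionalEquality using (_≡_)

open import Data.Nat using (zero; _+_; _∸_; _<_; _/_; NonZero; z≤n; s≤s)
open import Data.Nat.Base using (_!; nonTrivial⇒n>1; >-nonZero; >-nonZero⁻¹)
open import Data.Nat.Properties
open import Data.Nat.Divisibility
open import Data.Nat.DivMod using (m≡m%n+[m/n]*n)
open import Data.Nat.Primality using (euclidsLemma; prime⇒nonZero; prime⇒nonTrivial)
open import Data.Nat.Solver using (module +-*-Solver)
open import Data.Product using (_,_)
open import Data.Sum using (inj₁; inj₂)
open import Relation.Nullary using (¬_; yes; no; contradiction)
open import Relation.Binary.PropositionalEquality
  using (refl; sym; trans; cong; cong₂; subst; subst₂; module ≡-Reasoning)
open +-*-Solver

repunit : ℕ → ℕ → ℕ
repunit b zero    = 0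
repunit b (suc n) = 1 + b * repunit b n

repunit-+ : ∀ b a c → repunit b (a + c) ≡ repunit b a + b ^ a * repunit b c
repunit-+ b zero    c = sym (+-identityʳ _)
repunit-+ b (suc a) c = begin
  1 + b * repunit b (a + c)                   ≡⟨ cong (λ x → 1 + b * x) (repunit-+ b a c) ⟩
  1 + b * (repunit b a + b ^ a * repunit b c) ≡⟨ solve 4 (λ b x y z → con 1 :+ b :* (x :+ y :* z)
                                                              := con 1 :+ b :* x :+ b :* y :* z)
                                                   refl b (repunit b a) (b ^ a) (repunit b c) ⟩
  1 + b * repunit b a + b * b ^ a * repunit b c ∎
  where open ≡-Reasoning

repunit-suc : ∀ b n → repunit b (suc n) ≡ repunit b n + b ^ n
repunit-suc b zero    = cong (1 +_) (*-zeroʳ b)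
repunit-suc b (suc n) = begin
  1 + b * repunit b (suc n)        ≡⟨ cong (λ x → 1 + b * x) (repunit-suc b n) ⟩
  1 + b * (repunit b n + b ^ n)    ≡⟨ solve 3 (λ b r x → con 1 :+ b :* (r :+ x) := con 1 :+ b :* r :+ b :* x)
                                         refl b (repunit b n) (b ^ n) ⟩
  1 + b * repunit b n + b * b ^ n  ∎
  where open ≡-Reasoning

repunit-* : ∀ b a k → repunit b (a * k) ≡ repunit b a * repunit (b ^ a) k
repunit-* b a zero    = trans (cong (repunit b) (*-zeroʳ a)) (sym (*-zeroʳ (repunit b a)))
repunit-* b a (suc k) = begin
  repunit b (a * suc k)                                ≡⟨ cong (repunit b) (*-suc a k) ⟩
  repunit b (a + a * k)                                ≡⟨ repunit-+ b a (a * k) ⟩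
  repunit b a + b ^ a * repunit b (a * k)              ≡⟨ cong (λ x → repunit b a + b ^ a * x) (repunit-* b a k) ⟩
  repunit b a + b ^ a * (repunit b a * repunit B k)    ≡⟨ solve 3 (λ x y z → x :+ y :* (x :* z) := x :* (con 1 :+ y :* z))
                                                            refl (repunit b a) B (repunit B k) ⟩
  repunit b a * (1 + B * repunit B k)                  ∎
  where
  open ≡-Reasoning
  B = b ^ a

repunit-double : ∀ b n → repunit b (2 * n) ≡ repunit b n * (1 + b ^ n)
repunit-double b n = begin
  repunit b (2 * n)                  ≡⟨ cong (repunit b) (solve 1 (λ n → con 2 :* n := n :+ n) refl n) ⟩
  repunit b (n + n)                  ≡⟨ repunit-+ b n n ⟩
  repunit b n + b ^ n * repunit b n  ≡⟨ solve 2 (λ r x → r :+ x :* r := r :* (con 1 :+ x)) refl (repunit b n) (b ^ n) ⟩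
  repunit b n * (1 + b ^ n)          ∎
  where open ≡-Reasoning

repunit-geometric : ∀ b n → repunit (suc b) n * b + 1 ≡ suc b ^ n
repunit-geometric b zero    = refl
repunit-geometric b (suc n) = begin
  (1 + suc b * repunit (suc b) n) * b + 1 ≡⟨ solve 2 (λ b x → (con 1 :+ (con 1 :+ b) :* x) :* b :+ con 1
                                                         := (con 1 :+ b) :* (x :* b :+ con 1))
                                              refl b (repunit (suc b) n) ⟩
  suc b * (repunit (suc b) n * b + 1)     ≡⟨ cong (suc b *_) (repunit-geometric b n) ⟩
  suc b * suc b ^ n                       ∎
  where open ≡-Reasoning

repunit-geometric∸ : ∀ b n .{{_ : NonZero b}} → b ^ n ∸ 1 ≡ repunit b n * (b ∸ 1)
repunit-geometric∸ (suc b) n =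
  trans (cong (_∸ 1) (sym (repunit-geometric b n))) (m+n∸n≡m _ 1)

repunit-pos : ∀ b n .{{_ : NonZero n}} → 0 < repunit b n
repunit-pos b (suc n) = s≤s z≤n

-- For odd b, every 1 + b^j is even: with b = 1 + 2t, 1 + b^j = 2 (1 + R_b(j) t).
odd⇒2∣1+pow : ∀ b j → b % 2 ≡ 1 → 2 ∣ 1 + b ^ j
odd⇒2∣1+pow b j b-odd = subst (λ x → 2 ∣ 1 + x ^ j) (sym b≡1+2t) (divides (1 + repunit (1 + 2 * t) j * t) even)
  where
  open ≡-Reasoning
  t = b / 2
  b≡1+2t : b ≡ 1 + 2 * t
  b≡1+2t = trans (m≡m%n+[m/n]*n b 2) (cong₂ _+_ b-odd (*-comm t 2))
  r = repunit (1 + 2 * t) j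
  even : 1 + (1 + 2 * t) ^ j ≡ (1 + r * t) * 2
  even = begin
    1 + (1 + 2 * t) ^ j    ≡⟨ cong (1 +_) (sym (repunit-geometric (2 * t) j)) ⟩
    1 + (r * (2 * t) + 1)  ≡⟨ solve 2 (λ r t → con 1 :+ (r :* (con 2 :* t) :+ con 1) := (con 1 :+ r :* t) :* con 2) refl r t ⟩
    (1 + r * t) * 2        ∎

-- For odd b, 2^m divides R_b(2^m): each doubling of the length contributes
-- the even factor 1 + b^(2^m).
pow2∣repunit : ∀ b m → b % 2 ≡ 1 → 2 ^ m ∣ repunit b (2 ^ m)
pow2∣repunit b zero    _     = 1∣ _
pow2∣repunit b (suc m) b-odd =
  subst₂ _∣_ (*-comm (2 ^ m) 2) (sym (repunit-double b (2 ^ m)))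
             (*-pres-∣ (pow2∣repunit b m b-odd) (odd⇒2∣1+pow b (2 ^ m) b-odd))

risingFrom : ℕ → ℕ → ℕ
risingFrom a zero    = 1
risingFrom a (suc t) = (a + suc t) * risingFrom a t

factorial-+ : ∀ a t → (a + t) ! ≡ risingFrom a t * a !
factorial-+ a zero    = trans (cong _! (+-identityʳ a)) (sym (+-identityʳ _))
factorial-+ a (suc t) = begin
  (a + suc t) !                            ≡⟨ cong _! (+-suc a t) ⟩
  suc (a + t) * (a + t) !                  ≡⟨ cong₂ _*_ (sym (+-suc a t)) (factorial-+ a t) ⟩
  (a + suc t) * (risingFrom a t * a !)     ≡⟨ sym (*-assoc (a + suc t) _ _) ⟩
  (a + suc t) * risingFrom a t * a !       ∎
  where open ≡-Reasoning

module PrimeFactorials (p : ℕ) (p-prime : Prime p) where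

  instance
    p-nonZero : NonZero p
    p-nonZero = prime⇒nonZero p-prime

  1<p : 1 < p
  1<p = nonTrivial⇒n>1 p {{prime⇒nonTrivial p-prime}}

  ∤-* : ∀ a b → ¬ p ∣ a → ¬ p ∣ b → ¬ p ∣ a * b
  ∤-* a b p∤a p∤b p∣ab with euclidsLemma a b p-prime p∣ab
  ... | inj₁ p∣a = p∤a p∣a
  ... | inj₂ p∣b = p∤b p∣b

  ∤1 : ¬ p ∣ 1
  ∤1 p∣1 = <-irrefl (sym (∣1⇒≡1 p∣1)) 1<p

  ∤-risingFrom : ∀ M r → r < p → ¬ p ∣ risingFrom (p * M) r
  ∤-risingFrom M zero    _   = ∤1
  ∤-risingFrom M (suc r) r<p = ∤-* _ _ ∤-top (∤-risingFrom M r (<-trans (n<1+n r) r<p))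
    where
    ∤-top : ¬ p ∣ p * M + suc r
    ∤-top p∣ = <-irrefl refl (<-≤-trans r<p (∣⇒≤ (∣m+n∣m⇒∣n p∣ (m∣m*n M))))

  -- (pM)! = p^M * M! * c with p ∤ c: only the multiples of p among 1..pM
  -- contribute factors of p, and they are p*1, ..., p*M.
  factorial-multiple : ∀ M → Σ ℕ λ c → (¬ p ∣ c) × ((p * M) ! ≡ p ^ M * M ! * c)
  factorial-multiple zero    = 1 , ∤1 , cong _! (*-zeroʳ p)
  factorial-multiple (suc M) with factorial-multiple M
  ... | c , p∤c , eq = risingFrom (p * M) t * c , ∤-* _ _ (∤-risingFrom M t t<p) p∤c , eq′
    where
    open ≡-Reasoning
    t = p ∸ 1
    p≡1+t : p ≡ suc t
    p≡1+t = sym (trans (+-comm 1 t) (m∸n+n≡m (<⇒≤ 1<p)))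
    t<p : t < p
    t<p = subst (t <_) (sym p≡1+t) (n<1+n t)
    next : p * M + suc t ≡ p * suc M
    next = trans (cong (p * M +_) (sym p≡1+t)) (trans (+-comm (p * M) p) (sym (*-suc p M)))
    eq′ : (p * suc M) ! ≡ p ^ suc M * suc M ! * (risingFrom (p * M) t * c)
    eq′ = begin
      (p * suc M) !                                       ≡⟨ cong _! (sym next) ⟩
      (p * M + suc t) !                                   ≡⟨ factorial-+ (p * M) (suc t) ⟩
      (p * M + suc t) * risingFrom (p * M) t * (p * M) !  ≡⟨ cong₂ (λ x y → x * risingFrom (p * M) t * y) next eq ⟩
      p * suc M * risingFrom (p * M) t * (p ^ M * M ! * c)
        ≡⟨ solve 6 (λ p m x y z c → p :* (con 1 :+ m) :* x :* (y :* z :* c)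
                                 := p :* y :* ((con 1 :+ m) :* z) :* (x :* c))
             refl p M (risingFrom (p * M) t) (p ^ M) (M !) c ⟩
      p * p ^ M * (suc M * M !) * (risingFrom (p * M) t * c) ∎

  legendre-prime-power : ∀ n → Σ ℕ λ c → (¬ p ∣ c) × ((p ^ n) ! ≡ p ^ repunit p n * c)
  legendre-prime-power zero = 1 , ∤1 , refl
  legendre-prime-power (suc n) with legendre-prime-power n | factorial-multiple (p ^ n)
  ... | c₀ , p∤c₀ , eq₀ | c₁ , p∤c₁ , eq₁ = c₀ * c₁ , ∤-* _ _ p∤c₀ p∤c₁ , eq
    where
    open ≡-Reasoning
    eq : (p * p ^ n) ! ≡ p ^ repunit p (suc n) * (c₀ * c₁)
    eq = begin
      (p * p ^ n) !                                ≡⟨ eq₁ ⟩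
      p ^ (p ^ n) * (p ^ n) ! * c₁                 ≡⟨ cong (λ x → p ^ (p ^ n) * x * c₁) eq₀ ⟩
      p ^ (p ^ n) * (p ^ repunit p n * c₀) * c₁    ≡⟨ solve 4 (λ a b c d → a :* (b :* c) :* d := a :* b :* (c :* d))
                                                         refl (p ^ (p ^ n)) (p ^ repunit p n) c₀ c₁ ⟩
      p ^ (p ^ n) * p ^ repunit p n * (c₀ * c₁)    ≡⟨ cong (_* (c₀ * c₁)) (sym (^-distribˡ-+-* p (p ^ n) (repunit p n))) ⟩
      p ^ (p ^ n + repunit p n) * (c₀ * c₁)        ≡⟨ cong (λ x → p ^ x * (c₀ * c₁)) (trans (+-comm (p ^ n) _) (sym (repunit-suc p n))) ⟩
      p ^ repunit p (suc n) * (c₀ * c₁)            ∎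

  pow-mono-∣ : ∀ a b → a ≤ b → p ^ a ∣ p ^ b
  pow-mono-∣ a b a≤b = divides (p ^ (b ∸ a))
    (trans (cong (p ^_) (sym (m∸n+n≡m a≤b))) (^-distribˡ-+-* p (b ∸ a) a))

  exponent-bound : ∀ a v c → ¬ p ∣ c → p ^ a ∣ p ^ v * c → a ≤ v
  exponent-bound a v c p∤c p^a∣ with a ≤? v
  ... | yes a≤v = a≤v
  ... | no  a≰v = contradiction (*-cancelˡ-∣ (p ^ v) {{m^n≢0 p v}} p^v*p∣) p∤c
    where
    p^v*p∣ : p ^ v * p ∣ p ^ v * c
    p^v*p∣ = subst (_∣ p ^ v * c) (*-comm p (p ^ v)) (∣-trans (pow-mono-∣ (suc v) a (≰⇒> a≰v)) p^a∣)

  trailing-zeroes : ∀ q N e c .{{_ : NonZero q}} → ¬ p ∣ c → N ! ≡ p ^ (q * e) * c → IsZ (p ^ q) N e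
  trailing-zeroes q N e c p∤c N!≡ = B^e∣N! , maximal
    where
    B^e∣N! : (p ^ q) ^ e ∣ N !
    B^e∣N! = subst₂ _∣_ (sym (^-*-assoc p q e)) (sym N!≡) (m∣m*n c)
    maximal : ∀ e′ → (p ^ q) ^ e′ ∣ N ! → e′ ≤ e
    maximal e′ d = *-cancelˡ-≤ q (exponent-bound (q * e′) (q * e) c p∤c
      (subst₂ _∣_ (^-*-assoc p q e′) N!≡ d))

repdigit-trailing-zeroes : ∀ p q k → Prime p → .{{_ : NonZero q}} → q ∣ repunit p q →
  Σ ℕ λ e → IsZ (p ^ q) (p ^ (q * k)) e × Repdigit (p ^ q) k e
repdigit-trailing-zeroes p q k p-prime (divides α R≡αq) = e , zeroes , α , 1≤α , α≤B-1 , digits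
  where
  open PrimeFactorials p p-prime
  B = p ^ q
  e = α * repunit B k

  exponent : repunit p (q * k) ≡ q * e
  exponent = begin
    repunit p (q * k)        ≡⟨ repunit-* p q k ⟩
    repunit p q * repunit B k ≡⟨ cong (_* repunit B k) R≡αq ⟩
    α * q * repunit B k      ≡⟨ solve 3 (λ a q r → a :* q :* r := q :* (a :* r)) refl α q (repunit B k) ⟩
    q * e                    ∎
    where open ≡-Reasoning

  zeroes : IsZ B (p ^ (q * k)) e
  zeroes with legendre-prime-power (q * k)
  ... | c , p∤c , p^qk!≡ = trailing-zeroes q (p ^ (q * k)) e c p∤c (trans p^qk!≡ (cong (λ x → p ^ x * c) exponent))

  -- α q = R_p(q) is positive, so α is.
  1≤α : 1 ≤ α
  1≤α = >-nonZero⁻¹ α {{m*n≢0⇒m≢0 α {{subst NonZero R≡αq (>-nonZero (repunit-pos p q))}}}}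

  instance
    p-1-nonZero : NonZero (p ∸ 1)
    p-1-nonZero = >-nonZero (m<n⇒0<n∸m 1<p)

  α≤B-1 : α ≤ B ∸ 1
  α≤B-1 = begin
    α                         ≤⟨ m≤m*n α q ⟩
    α * q                     ≤⟨ m≤m*n (α * q) (p ∸ 1) ⟩
    α * q * (p ∸ 1)           ≡⟨ cong (_* (p ∸ 1)) (sym R≡αq) ⟩
    repunit p q * (p ∸ 1)     ≡⟨ sym (repunit-geometric∸ p q) ⟩
    B ∸ 1                     ∎
    where open ≤-Reasoning

  digits : e * (B ∸ 1) ≡ α * (B ^ k ∸ 1)
  digits = trans (*-assoc α (repunit B k) (B ∸ 1))
                 (cong (α *_) (sym (repunit-geometric∸ B k {{m^n≢0 p q}})))

proposition4 : (p m k : ℕ) → Prime p → p % 2 ≡ 1 → 1 ≤ m → 1 ≤ k →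
    Σ ℕ λ e → IsZ (p ^ (2 ^ m)) (p ^ (2 ^ m * k)) e × Repdigit (p ^ (2 ^ m)) k e
proposition4 p m k p-prime p-odd _ _ =
  repdigit-trailing-zeroes p (2 ^ m) k p-prime {{m^n≢0 2 m}} (pow2∣repunit p m p-odd)
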